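{- Let $w\in\widetilde{S}_n$ be not the identity, suppose $w$ avoids $3412$ and $4231$, and let $\alpha$, $v=w_\alpha w_{i_1}\cdots w_{i_p}$ be as in the context. Suppose $v$ is interrupted, and let $w_\beta$ be the largest value of $w$ that interrupts $v$. Then $w_\beta>w_{\beta+1}>\cdots>w_{i_p}$, i.e. $w_\beta$ starts a consecutive decreasing subword of the one-line notation of $w$ ending in $w_{i_p}$.
   Context: $\widetilde{S}_n$ is the set of bijections $w:\mathbb{Z}\to\mathbb{Z}$ with $w(i+n)=w(i)+n$ and $\sum_{i=1}^n w(i)=\binom{n+1}{2}$; write $w_i=w(i)$. Pattern containment: $w$ contains $p\in S_k$ if there exist integers $i_1<\dots<i_k$ with $w_{i_1},\dots,w_{i_k}$ in the same relative order as $p$. For $\gamma\in\mathbb{Z}$, the subword of $\gamma$-inversions of $w$ is $w_\gamma w_{j_1}\cdots w_{j_t}$ where $j_1<\dots<j_t$ are all indices $j>\gamma$ with $w_j<w_\gamma$; it is nontrivial if $t\ge1$. Let $\alpha\in\{1,\dots,n\}$ be the index such that $w_\alpha$ is the largest value among $w_1,\dots,w_n$ with nontrivial subword of $\alpha$-inversions, and $v=w_\alpha w_{i_1}\cdots w_{i_p}$ that subword. $v$ is uninterrupted if $\alpha,i_1,\dots,i_p$ are consecutive integers, and interrupted otherwise. A value $w_\beta$ interrupts $v$ if $\alpha<\beta<i_p$ and $w_\beta>w_\alpha$. -}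

module Defs where

open import Data.Nat using (ℕ; suc)
open import Data.Nat.Combinatorics using (_C_)
open import Data.Integer using (ℤ; +_; _+_; _<_; _≤_)
open import Data.List using (List; map; upTo)
open import Data.Integer.Base using () renaming (_+_ to _+ℤ_)
open import Data.Product using (_×_; ∃; ∃-syntax)
open import Relation.Binary.PropositionalEquality using (_≡_)
open import Relation.Nullary using (¬_)
open import Function.Definitions using (Bijective)

sumℤ : List ℤ → ℤ
sumℤ Data.List.[] = + 0
sumℤ (x Data.List.∷ xs) = x + sumℤ xs

oneTo : ℕ → List ℕ
oneTo n = map suc (upTo n)

record IsAffinePerm (n : ℕ) (w : ℤ → ℤ) : Set where
  field
    bijective : Bijective _≡_ _≡_ w
    periodic  : ∀ i → w (i + + n) ≡ w i + + n
    window    : sumℤ (map (λ i → w (+ i)) (oneTo n)) ≡ + (suc n C 2)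

IsIdentity : (ℤ → ℤ) → Set
IsIdentity w = ∀ i → w i ≡ i

Contains3412 : (ℤ → ℤ) → Set
Contains3412 w = ∃[ a ] ∃[ b ] ∃[ c ] ∃[ d ]
  (a < b × b < c × c < d × w c < w d × w d < w a × w a < w b)

Contains4231 : (ℤ → ℤ) → Set
Contains4231 w = ∃[ a ] ∃[ b ] ∃[ c ] ∃[ d ]
  (a < b × b < c × c < d × w d < w b × w b < w c × w c < w a)

NontrivialInv : (ℤ → ℤ) → ℤ → Set
NontrivialInv w γ = ∃[ j ] (γ < j × w j < w γ)

IsAlpha : ℕ → (ℤ → ℤ) → ℤ → Set
IsAlpha n w α =
  (+ 1 ≤ α × α ≤ + n) × NontrivialInv w α ×
  (∀ γ → + 1 ≤ γ → γ ≤ + n → NontrivialInv w γ → w γ ≤ w α)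

IsLastInv : (ℤ → ℤ) → ℤ → ℤ → Set
IsLastInv w α ip = (α < ip × w ip < w α) × (∀ j → ip < j → ¬ (w j < w α))

-- v = w_α w_{i_1} ... w_{i_p} is interrupted: α, i_1, ..., i_p not consecutive,
-- i.e. some index strictly between α and i_p is not an α-inversion index
Interrupted : (ℤ → ℤ) → ℤ → ℤ → Set
Interrupted w α ip = ∃[ k ] (α < k × k < ip × ¬ (w k < w α))

Interrupts : (ℤ → ℤ) → ℤ → ℤ → ℤ → Set
Interrupts w α ip β = α < β × β < ip × w α < w β

IsLargestInterrupter : (ℤ → ℤ) → ℤ → ℤ → ℤ → Set
IsLargestInterrupter w α ip β =
  Interrupts w α ip β × (∀ γ → Interrupts w α ip γ → w γ ≤ w β)

DecreasingRun : (ℤ → ℤ) → ℤ → ℤ → Set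
DecreasingRun w β ip = ∀ k → β ≤ k → k < ip → w (k + + 1) < w k

-- Suppose w_k < w_{k+1} for some β ≤ k < i_p. Since w_{k+1} ≠ w_β, maximality of the
-- interrupter w_β forces w_{k+1} < w_β (in particular k ≠ β). Now w_k ≠ w_{i_p}:
-- if w_k < w_{i_p} then w_α w_β w_k w_{i_p} is a 3412, and if w_k > w_{i_p} then
-- w_β w_k w_{k+1} w_{i_p} is a 4231.
module Submission where

open import Defs
open import Data.Nat using (ℕ)
open import Data.Integer using (ℤ; +_; _+_; _<_; _≤_)
open import Data.Integer.Properties
open import Data.Product using (_,_; proj₁; proj₂)
open import Data.Sum using (_⊎_; inj₁; inj₂; [_,_])
open import Data.Empty using (⊥-elim)
open import Function using (_∘_)
open import Function.Definitions using (Injective)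
open import Relation.Nullary using (¬_)
open import Relation.Binary.PropositionalEquality using (_≡_; _≢_; refl; sym; subst)
open import Relation.Binary.Definitions using (tri<; tri≈; tri>)

i<i+1 : ∀ i → i < i + + 1
i<i+1 i = suc[i]≤j⇒i<j (≤-reflexive (+-comm (+ 1) i))

i<j⇒i+1≤j : ∀ {i j} → i < j → i + + 1 ≤ j
i<j⇒i+1≤j {i} p = subst (_≤ _) (+-comm (+ 1) i) (i<j⇒suc[i]≤j p)

≤∧value-above⇒< : ∀ (w : ℤ → ℤ) {i j} → i ≤ j → w j < w i → i < j
≤∧value-above⇒< w i≤j wj<wi = ≤∧≢⇒< i≤j λ { refl → <-irrefl refl wj<wi }

module _ {w : ℤ → ℤ} (w-injective : Injective _≡_ _≡_ w) where

  ≢⇒w≢ : ∀ {i j} → i ≢ j → w i ≢ w j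
  ≢⇒w≢ i≢j wi≡wj = i≢j (w-injective wi≡wj)

  <⇒w≢ : ∀ {i j} → i < j → w i ≢ w j
  <⇒w≢ i<j = ≢⇒w≢ (<⇒≢ i<j)

  ¬ascent⇒descent : ∀ k → ¬ (w k < w (k + + 1)) → w (k + + 1) < w k
  ¬ascent⇒descent k ¬asc = ≤∧≢⇒< (≮⇒≥ ¬asc) (≢⇒w≢ (<⇒≢ (i<i+1 k) ∘ sym))

  module Interrupter {α ip β : ℤ} (wip<wα : w ip < w α)
           (largest : IsLargestInterrupter w α ip β) where

    private
      α<β : α < β
      α<β = proj₁ (proj₁ largest)

      wα<wβ : w α < w β
      wα<wβ = proj₂ (proj₂ (proj₁ largest))

      maximal : ∀ γ → Interrupts w α ip γ → w γ ≤ w β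
      maximal = proj₂ largest

    interrupts-if-above : ∀ {j} → α < j → j ≤ ip → w α < w j → Interrupts w α ip j
    interrupts-if-above α<j j≤ip wα<wj =
      α<j , ≤∧value-above⇒< w j≤ip (<-trans wip<wα wα<wj) , wα<wj

    below-interrupter : ∀ {j} → β < j → j ≤ ip → w j < w β
    below-interrupter {j} β<j j≤ip with <-cmp (w j) (w α)
    ... | tri< wj<wα _ _ = <-trans wj<wα wα<wβ
    ... | tri≈ _ wj≡wα _ = ⊥-elim (<⇒w≢ (<-trans α<β β<j) (sym wj≡wα))
    ... | tri> _ _ wα<wj = ≤∧≢⇒< (maximal j (interrupts-if-above (<-trans α<β β<j) j≤ip wα<wj))
                                  (<⇒w≢ β<j ∘ sym)

    ascent-lies-beyond-interrupter : ∀ {k} → β ≤ k → k < ip → w k < w (k + + 1) → β < k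
    ascent-lies-beyond-interrupter {k} β≤k k<ip wk<wk1 = ≤∧≢⇒< β≤k λ { refl →
      <-asym wk<wk1 (below-interrupter (≤-<-trans β≤k (i<i+1 k)) (i<j⇒i+1≤j k<ip)) }

    ascent⇒3412⊎4231 : ∀ {k} → β < k → k < ip → w k < w (k + + 1) →
                       Contains3412 w ⊎ Contains4231 w
    ascent⇒3412⊎4231 {k} β<k k<ip wk<wk1 with <-cmp (w k) (w ip)
    ... | tri< wk<wip _ _ = inj₁ (α , β , k , ip , α<β , β<k , k<ip , wk<wip , wip<wα , wα<wβ)
    ... | tri≈ _ wk≡wip _ = ⊥-elim (<⇒w≢ k<ip wk≡wip)
    ... | tri> _ _ wip<wk = inj₂ (β , k , k + + 1 , ip , β<k , i<i+1 k ,
                                  ≤∧value-above⇒< w k+1≤ip (<-trans wip<wk wk<wk1) ,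
                                  wip<wk , wk<wk1 ,
                                  below-interrupter (<-trans β<k (i<i+1 k)) k+1≤ip)
      where k+1≤ip = i<j⇒i+1≤j k<ip

lemma3p3 : (n : ℕ) (w : ℤ → ℤ) → IsAffinePerm n w → ¬ IsIdentity w →
    ¬ Contains3412 w → ¬ Contains4231 w →
    (α ip : ℤ) → IsAlpha n w α → IsLastInv w α ip →
    Interrupted w α ip →
    (β : ℤ) → IsLargestInterrupter w α ip β →
    DecreasingRun w β ip
lemma3p3 n w aff _ avoids3412 avoids4231 α ip _ ((_ , wip<wα) , _) _ β largest k β≤k k<ip =
  ¬ascent⇒descent w-injective k λ ascent →
    [ avoids3412 , avoids4231 ]
      (ascent⇒3412⊎4231 (ascent-lies-beyond-interrupter β≤k k<ip ascent) k<ip ascent)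
  where
  w-injective : Injective _≡_ _≡_ w
  w-injective = proj₁ (IsAffinePerm.bijective aff)
  open Interrupter w-injective wip<wα largest
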